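{- Let $G=(V,E)$ be a graph, let $R,t,M$ be integers with $1\le M\le R$, and let $x,y\in V$. Let $\mathbf M$ be the random walk transition matrix of $G$ and let $Z$ be the output of $\textsc{EstRWDot}(G,R,t,M,x,y)$. Then $$\mathbb E[Z]=\langle\mathbf M^t\mathbb 1_x,\mathbf M^t\mathbb 1_y\rangle,$$ $$\mathrm{Var}[Z]\le\frac1R\left[\frac1M\|\mathbf M^t\mathbb 1_x\|_2\|\mathbf M^t\mathbb 1_y\|_2+\left(\|\mathbf M^t\mathbb 1_x\|_2\|\mathbf M^t\mathbb 1_y\|_2^2+\|\mathbf M^t\mathbb 1_x\|_2^2\|\mathbf M^t\mathbb 1_y\|_2\right)\right].$$
   Context: $\mathbf M$ is the transition matrix of the random walk used by the algorithm (for $d$-regular $G$, the lazy walk $\mathbf M=\frac12(I+A/d)$); $\mathbb 1_x$ is the indicator vector of $x$. $\textsc{EstRWDot}(G,R,t,M,x,y)$: for each of $B=R/M$ batches $b$ (independently), run $M$ independent random walks of length $t$ from $x$ and $M$ from $y$, let $\hat p_x(i)$ (resp. $\hat p_y(i)$) be the fraction of walks from $x$ (resp. $y$) in this batch ending at $i$, and set $Z_b=\langle\hat p_x,\hat p_y\rangle$; output $Z=\frac1B\sum_{b=1}^BZ_b$. -}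

module Defs where

open import Data.Bool using (Bool; true; false; if_then_else_)
open import Data.Nat as ℕ using (ℕ; zero; suc)
open import Data.Fin using (Fin; _≟_)
open import Data.Integer using (+_)
open import Data.Rational using (ℚ; 0ℚ; 1ℚ; ½; _+_; _*_; _-_; _/_)
open import Data.List using (List; []; _∷_; map; concatMap; foldr; filterᵇ; length; allFin)
open import Data.Product using (_×_; _,_)
open import Relation.Nullary.Decidable using (⌊_⌋)
open import Relation.Binary.PropositionalEquality using (_≡_)

-- 1/n as a rational, with the (never used) convention inv 0 = 0.
inv : ℕ → ℚ
inv zero    = 0ℚ
inv (suc n) = + 1 / suc n

ℕ→ℚ : ℕ → ℚ
ℕ→ℚ n = + n / 1

sumℚ : List ℚ → ℚ
sumℚ = foldr _+_ 0ℚ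

Σ[V] : {n : ℕ} → (Fin n → ℚ) → ℚ
Σ[V] {n} f = sumℚ (map f (allFin n))

Adj : ℕ → Set
Adj n = Fin n → Fin n → Bool

nbrs : {n : ℕ} → Adj n → Fin n → List (Fin n)
nbrs {n} A i = filterᵇ (A i) (allFin n)

IsSimpleGraph : {n : ℕ} → Adj n → Set
IsSimpleGraph {n} A = (∀ i j → A i j ≡ A j i) × (∀ i → A i i ≡ false)

IsRegular : {n : ℕ} → Adj n → ℕ → Set
IsRegular {n} A d = ∀ i → length (nbrs A i) ≡ d

-- Lazy random-walk matrix 𝐌 = ½ (I + A/d), acting on vectors Fin n → ℚ

Vecℚ : ℕ → Set
Vecℚ n = Fin n → ℚ

indicator : {n : ℕ} → Fin n → Vecℚ n
indicator x i = if ⌊ x ≟ i ⌋ then 1ℚ else 0ℚ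

applyM : {n : ℕ} → Adj n → ℕ → Vecℚ n → Vecℚ n
applyM A d v i = ½ * v i + (½ * inv d) * sumℚ (map v (nbrs A i))

powM : {n : ℕ} → Adj n → ℕ → ℕ → Vecℚ n → Vecℚ n
powM A d zero    v = v
powM A d (suc t) v = applyM A d (powM A d t v)

inner : {n : ℕ} → Vecℚ n → Vecℚ n → ℚ
inner u v = Σ[V] (λ i → u i * v i)

normSq : {n : ℕ} → Vecℚ n → ℚ
normSq v = inner v v

Dist : Set → Set
Dist X = List (ℚ × X)

pure : {X : Set} → X → Dist X
pure x = (1ℚ , x) ∷ []

bind : {X Y : Set} → Dist X → (X → Dist Y) → Dist Y
bind μ f = concatMap (λ { (p , a) → map (λ { (q , b) → (p * q , b) }) (f a) }) μ

mapD : {X Y : Set} → (X → Y) → Dist X → Dist Y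
mapD f μ = map (λ { (p , a) → (p , f a) }) μ

iid : {X : Set} → ℕ → Dist X → Dist (List X)
iid zero    μ = pure []
iid (suc k) μ = bind μ (λ a → mapD (a ∷_) (iid k μ))

𝔼 : Dist ℚ → ℚ
𝔼 μ = sumℚ (map (λ { (p , z) → p * z }) μ)

Var : Dist ℚ → ℚ
Var μ = 𝔼 (mapD (λ z → z * z) μ) - 𝔼 μ * 𝔼 μ

lazyStep : {n : ℕ} → Adj n → ℕ → Fin n → Dist (Fin n)
lazyStep A d v = (½ , v) ∷ map (λ w → (½ * inv d , w)) (nbrs A v)

walk : {n : ℕ} → Adj n → ℕ → ℕ → Fin n → Dist (Fin n)
walk A d zero    v = pure v
walk A d (suc t) v = bind (walk A d t v) (lazyStep A d)

count : {n : ℕ} → Fin n → List (Fin n) → ℕ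
count i ws = length (filterᵇ (λ w → ⌊ w ≟ i ⌋) ws)

empirical : {n : ℕ} → ℕ → List (Fin n) → Vecℚ n
empirical M ws i = ℕ→ℚ (count i ws) * inv M

batchZ : {n : ℕ} → Adj n → ℕ → ℕ → ℕ → Fin n → Fin n → Dist ℚ
batchZ A d t M x y =
  bind (iid M (walk A d t x)) (λ wx →
  bind (iid M (walk A d t y)) (λ wy →
  pure (inner (empirical M wx) (empirical M wy))))

-- R / M as a natural number (convention: R div 0 = 0, never used since M ≥ 1)
_div_ : ℕ → ℕ → ℕ
R div zero    = zero
R div (suc m) = R ℕ./ suc m

EstRWDot : {n : ℕ} → Adj n → ℕ → ℕ → ℕ → ℕ → Fin n → Fin n → Dist ℚ
EstRWDot A d R t M x y =
  mapD (λ zs → inv B * sumℚ zs) (iid B (batchZ A d t M x y))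
  where B = R div M

{-# OPTIONS --safe #-}
-- Z is the average of B = R / M independent copies of the batch statistic Z_b = ⟨p̂_x, p̂_y⟩, so
-- E Z = E Z_b and Var Z = Var Z_b / B.  As A is symmetric, the endpoint of a t-step walk from x has
-- law p = 𝐌ᵗ 1_x, and p̂_x is the empirical distribution of M independent endpoints, whence
-- E p̂_x(i) = p(i) and E p̂_x(i) p̂_x(j) = δᵢⱼ p(i) / M + (1 - 1/M) p(i) p(j).  Independence of the
-- x- and y-walks gives E Z_b = ⟨p, q⟩ and
--   E Z_b² = Σᵢ pᵢ qᵢ (1/M² + (1/M)(1 - 1/M)(pᵢ + qᵢ) + (1 - 1/M)² ⟨p, q⟩).
-- Bounding pᵢ ≤ ‖p‖ ≤ a, qᵢ ≤ ‖q‖ ≤ b and ⟨p, q⟩ ≤ a b (Cauchy–Schwarz, from Lagrange's identity)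
-- yields Var Z_b ≤ (1/M)(a b / M + a b² + a² b), and 1/R = (1/B)(1/M).
module Submission where

open import Defs
open import Data.Nat as ℕ using (ℕ; zero; suc; _≤_; NonZero; >-nonZero; s≤s; z≤n)
open import Data.Nat.Coprimality as Coprime using (1-coprimeTo)
import Data.Integer as ℤ
import Data.Rational as ℚ
open import Data.Rational using (ℚ; 0ℚ; 1ℚ; ½; _+_; _*_; _-_; mkℚ; *≤*; nonNegative; nonPositive; positive) renaming (_≤_ to _≤ℚ_; _<_ to _<ℚ_)
import Data.Rational.Properties as ℚ
import Data.Integer.Properties as ℤ
open import Relation.Binary.PropositionalEquality
open import Data.Rational.Solver using (module +-*-Solver)
open +-*-Solver using (solve; _:+_; _:*_; _:-_; con; _:=_)
open import Relation.Nullary using (yes; no)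
open import Data.Bool using (Bool; true; false; if_then_else_)
open import Data.Fin as Fin using (Fin; _≟_)
open import Data.List using (List; []; _∷_; _++_; map; filterᵇ; length; allFin)
import Data.List.Properties as List
open import Data.Nat.DivMod using (_/_; m≥n⇒m/n>0; m/n*n≡m)
open import Data.Nat.Divisibility using (_∣_)
open import Data.Sum using (inj₁; inj₂)
open import Data.Empty using (⊥-elim)
open import Data.Product using (_×_; _,_)

-- Rational arithmetic

ℕ→ℚ-suc : ∀ n → ℕ→ℚ (suc n) ≡ 1ℚ + ℕ→ℚ n
ℕ→ℚ-suc n = sym (begin
  1ℚ + ℕ→ℚ n                          ≡⟨ cong (λ q → 1ℚ + q) (ℚ.normalize-coprime (Coprime.sym (1-coprimeTo n))) ⟩
  (ℤ.+ 1 ℤ.+ ℤ.+ n ℤ.* ℤ.+ 1) ℚ./ 1   ≡⟨ cong (λ k → (ℤ.+ 1 ℤ.+ k) ℚ./ 1) (ℤ.*-identityʳ (ℤ.+ n)) ⟩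
  ℕ→ℚ (suc n)                         ∎)
  where open ≡-Reasoning

inv-mkℚ : ∀ k → inv (suc k) ≡ mkℚ (ℤ.+ 1) k (1-coprimeTo (suc k))
inv-mkℚ k = ℚ.normalize-coprime (1-coprimeTo (suc k))

inv-inverseˡ : ∀ k .{{_ : NonZero k}} → inv k * ℕ→ℚ k ≡ 1ℚ
inv-inverseˡ (suc k) rewrite inv-mkℚ k | ℚ.normalize-coprime (Coprime.sym (1-coprimeTo (suc k))) =
  ℚ.*-inverseˡ (mkℚ (ℤ.+ suc k) 0 (Coprime.sym (1-coprimeTo (suc k))))

inv-* : ∀ a b .{{_ : NonZero a}} .{{_ : NonZero b}} → inv (a ℕ.* b) ≡ inv a * inv b
inv-* (suc a) (suc b) rewrite inv-mkℚ a | inv-mkℚ b = refl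

0≤½ : 0ℚ ≤ℚ ½
0≤½ = *≤* (ℤ.+≤+ z≤n)

0≤1 : 0ℚ ≤ℚ 1ℚ
0≤1 = *≤* (ℤ.+≤+ z≤n)

inv-nonNeg : ∀ k → 0ℚ ≤ℚ inv k
inv-nonNeg zero    = ℚ.≤-refl
inv-nonNeg (suc k) = ℚ.nonNegative⁻¹ _ {{ℚ.normalize-nonNeg 1 (suc k)}}

inv≤1 : ∀ k → inv k ≤ℚ 1ℚ
inv≤1 zero    = 0≤1
inv≤1 (suc k) rewrite inv-mkℚ k = *≤* (ℤ.+≤+ (s≤s z≤n))

+-nonNeg : ∀ {p q} → 0ℚ ≤ℚ p → 0ℚ ≤ℚ q → 0ℚ ≤ℚ p + q
+-nonNeg {p} {q} 0≤p 0≤q =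
  ℚ.nonNegative⁻¹ _ {{ℚ.nonNeg+nonNeg⇒nonNeg p {{nonNegative 0≤p}} q {{nonNegative 0≤q}}}}

*-nonNeg : ∀ {p q} → 0ℚ ≤ℚ p → 0ℚ ≤ℚ q → 0ℚ ≤ℚ p * q
*-nonNeg {p} {q} 0≤p 0≤q =
  ℚ.nonNegative⁻¹ _ {{ℚ.nonNeg*nonNeg⇒nonNeg p {{nonNegative 0≤p}} q {{nonNegative 0≤q}}}}

*-self-nonNeg : ∀ p → 0ℚ ≤ℚ p * p
*-self-nonNeg p with ℚ.≤-total 0ℚ p
... | inj₁ 0≤p = *-nonNeg 0≤p 0≤p
... | inj₂ p≤0 = ℚ.nonNegative⁻¹ _ {{ℚ.nonPos*nonPos⇒nonPos p {{nonPositive p≤0}} p {{nonPositive p≤0}}}}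

*-monoˡ-≤-0≤ : ∀ {r p q} → 0ℚ ≤ℚ r → p ≤ℚ q → r * p ≤ℚ r * q
*-monoˡ-≤-0≤ {r} 0≤r = ℚ.*-monoˡ-≤-nonNeg r {{nonNegative 0≤r}}

*-monoʳ-≤-0≤ : ∀ {r p q} → 0ℚ ≤ℚ r → p ≤ℚ q → p * r ≤ℚ q * r
*-monoʳ-≤-0≤ {r} 0≤r = ℚ.*-monoʳ-≤-nonNeg r {{nonNegative 0≤r}}

*-self-≤⇒≤ : ∀ {p q} → 0ℚ ≤ℚ q → p * p ≤ℚ q * q → p ≤ℚ q
*-self-≤⇒≤ {p} {q} 0≤q p²≤q² with p ℚ.≤? q
... | yes p≤q = p≤q
... | no  p≰q = ⊥-elim (ℚ.<-irrefl refl (ℚ.<-≤-trans q²<p² p²≤q²))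
  where
  q<p : q <ℚ p
  q<p = ℚ.≰⇒> p≰q
  q²<p² : q * q <ℚ p * p
  q²<p² = ℚ.≤-<-trans (*-monoˡ-≤-0≤ 0≤q (ℚ.<⇒≤ q<p))
                      (ℚ.*-monoˡ-<-pos p {{positive (ℚ.≤-<-trans 0≤q q<p)}} q<p)

p≤q⇒0≤q-p : ∀ {p q} → p ≤ℚ q → 0ℚ ≤ℚ q - p
p≤q⇒0≤q-p {p} {q} p≤q = subst (_≤ℚ q - p) (ℚ.+-inverseʳ p) (ℚ.+-monoˡ-≤ (ℚ.- p) p≤q)

≤-+-nonNeg : ∀ p {d} → 0ℚ ≤ℚ d → p ≤ℚ p + d
≤-+-nonNeg p 0≤d = subst (_≤ℚ p + _) (ℚ.+-identityʳ p) (ℚ.+-monoʳ-≤ p 0≤d)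

-- Finite sums

∑ : {X : Set} → List X → (X → ℚ) → ℚ
∑ l f = sumℚ (map f l)

syntax ∑ l (λ x → e) = ∑[ x ∈ l ] e

module _ {X : Set} where

  ∑-cong : ∀ (l : List X) {f g : X → ℚ} → (∀ x → f x ≡ g x) → ∑ l f ≡ ∑ l g
  ∑-cong []      f≗g = refl
  ∑-cong (x ∷ l) f≗g = cong₂ _+_ (f≗g x) (∑-cong l f≗g)

  ∑-+ : ∀ (l : List X) (f g : X → ℚ) → ∑[ x ∈ l ] (f x + g x) ≡ ∑ l f + ∑ l g
  ∑-+ []      f g = refl
  ∑-+ (x ∷ l) f g = trans (cong (f x + g x +_) (∑-+ l f g)) (interchange (f x) (g x) (∑ l f) (∑ l g))
    where
    interchange : ∀ a b c d → a + b + (c + d) ≡ a + c + (b + d)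
    interchange = solve 4 (λ a b c d → a :+ b :+ (c :+ d) := a :+ c :+ (b :+ d)) refl

  ∑-*ˡ : ∀ (l : List X) (c : ℚ) (f : X → ℚ) → ∑[ x ∈ l ] (c * f x) ≡ c * ∑ l f
  ∑-*ˡ []      c f = sym (ℚ.*-zeroʳ c)
  ∑-*ˡ (x ∷ l) c f = trans (cong (c * f x +_) (∑-*ˡ l c f)) (sym (ℚ.*-distribˡ-+ c (f x) (∑ l f)))

  ∑-*ʳ : ∀ (l : List X) (c : ℚ) (f : X → ℚ) → ∑[ x ∈ l ] (f x * c) ≡ ∑ l f * c
  ∑-*ʳ []      c f = sym (ℚ.*-zeroˡ c)
  ∑-*ʳ (x ∷ l) c f = trans (cong (f x * c +_) (∑-*ʳ l c f)) (sym (ℚ.*-distribʳ-+ c (f x) (∑ l f)))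

  ∑-mono-≤ : ∀ (l : List X) {f g : X → ℚ} → (∀ x → f x ≤ℚ g x) → ∑ l f ≤ℚ ∑ l g
  ∑-mono-≤ []      f≤g = ℚ.≤-refl
  ∑-mono-≤ (x ∷ l) f≤g = ℚ.+-mono-≤ (f≤g x) (∑-mono-≤ l f≤g)

  ∑-nonNeg : ∀ (l : List X) {f : X → ℚ} → (∀ x → 0ℚ ≤ℚ f x) → 0ℚ ≤ℚ ∑ l f
  ∑-nonNeg []      0≤f = ℚ.≤-refl
  ∑-nonNeg (x ∷ l) 0≤f = +-nonNeg (0≤f x) (∑-nonNeg l 0≤f)

  ∑∑-+ : ∀ (l : List X) (f g : X → X → ℚ) →
         ∑[ x ∈ l ] ∑[ y ∈ l ] (f x y + g x y) ≡ ∑[ x ∈ l ] ∑[ y ∈ l ] f x y + ∑[ x ∈ l ] ∑[ y ∈ l ] g x y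
  ∑∑-+ l f g = trans (∑-cong l (λ x → ∑-+ l (f x) (g x))) (∑-+ l (λ x → ∑ l (f x)) (λ x → ∑ l (g x)))

∑-*-∑ : ∀ {X Y : Set} (l : List X) (l′ : List Y) (f : X → ℚ) (g : Y → ℚ) →
        ∑ l f * ∑ l′ g ≡ ∑[ x ∈ l ] ∑[ y ∈ l′ ] (f x * g y)
∑-*-∑ l l′ f g = trans (sym (∑-*ʳ l (∑ l′ g) f)) (∑-cong l (λ x → sym (∑-*ˡ l′ (f x) g)))

𝟙[_] : Bool → ℚ
𝟙[ b ] = if b then 1ℚ else 0ℚ

∑-filterᵇ : ∀ {X : Set} (p : X → Bool) (l : List X) (g : X → ℚ) →
            ∑ (filterᵇ p l) g ≡ ∑[ x ∈ l ] (𝟙[ p x ] * g x)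
∑-filterᵇ p []      g = refl
∑-filterᵇ p (x ∷ l) g with p x
... | true  = cong₂ _+_ (sym (ℚ.*-identityˡ (g x))) (∑-filterᵇ p l g)
... | false = trans (∑-filterᵇ p l g) (sym (trans (cong (_+ _) (ℚ.*-zeroˡ (g x))) (ℚ.+-identityˡ _)))

Σ[V]-suc : ∀ {n} (f : Fin (suc n) → ℚ) → Σ[V] f ≡ f Fin.zero + Σ[V] (λ i → f (Fin.suc i))
Σ[V]-suc f = cong (λ l → f Fin.zero + sumℚ l)
  (trans (List.map-tabulate Fin.suc f) (sym (List.map-tabulate (λ i → i) (λ i → f (Fin.suc i)))))

module _ {n : ℕ} where

  indicator-sym : (i j : Fin n) → indicator i j ≡ indicator j i
  indicator-sym i j with i ≟ j | j ≟ i
  ... | yes _   | yes _   = refl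
  ... | no  _   | no  _   = refl
  ... | yes i≡j | no  j≢i = ⊥-elim (j≢i (sym i≡j))
  ... | no  i≢j | yes j≡i = ⊥-elim (i≢j (sym j≡i))

  indicator-self : (i : Fin n) → indicator i i ≡ 1ℚ
  indicator-self i with i ≟ i
  ... | yes _   = refl
  ... | no  i≢i = ⊥-elim (i≢i refl)

  indicator-* : (w i j : Fin n) → indicator w i * indicator w j ≡ indicator i j * indicator w i
  indicator-* w i j with w ≟ i
  ... | yes refl = ℚ.*-comm 1ℚ (indicator w j)
  ... | no  _    = trans (ℚ.*-zeroˡ (indicator w j)) (sym (ℚ.*-zeroʳ (indicator i j)))

indicator-nonNeg : ∀ {n} (x i : Fin n) → 0ℚ ≤ℚ indicator x i
indicator-nonNeg x i with x ≟ i
... | yes _ = 0≤1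
... | no  _ = ℚ.≤-refl

indicator-suc : ∀ {n} (i j : Fin n) → indicator (Fin.suc i) (Fin.suc j) ≡ indicator i j
indicator-suc i j with i ≟ j
... | yes refl = refl
... | no  _    = refl

Σ[V]-indicator : ∀ {n} (i : Fin n) (g : Vecℚ n) → Σ[V] (λ j → indicator i j * g j) ≡ g i
Σ[V]-indicator {suc n} Fin.zero g = begin
  Σ[V] (λ j → indicator Fin.zero j * g j)               ≡⟨ Σ[V]-suc (λ j → indicator Fin.zero j * g j) ⟩
  1ℚ * g Fin.zero + Σ[V] (λ j → 0ℚ * g (Fin.suc j))     ≡⟨ cong₂ _+_ (ℚ.*-identityˡ (g Fin.zero)) (∑-*ˡ (allFin n) 0ℚ (λ j → g (Fin.suc j))) ⟩
  g Fin.zero + 0ℚ * Σ[V] (λ j → g (Fin.suc j))          ≡⟨ cong (g Fin.zero +_) (ℚ.*-zeroˡ (Σ[V] (λ j → g (Fin.suc j)))) ⟩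
  g Fin.zero + 0ℚ                                       ≡⟨ ℚ.+-identityʳ (g Fin.zero) ⟩
  g Fin.zero                                            ∎
  where open ≡-Reasoning
Σ[V]-indicator {suc n} (Fin.suc i) g = begin
  Σ[V] (λ j → indicator (Fin.suc i) j * g j)                              ≡⟨ Σ[V]-suc (λ j → indicator (Fin.suc i) j * g j) ⟩
  0ℚ * g Fin.zero + Σ[V] (λ j → indicator (Fin.suc i) (Fin.suc j) * g (Fin.suc j))
    ≡⟨ cong₂ _+_ (ℚ.*-zeroˡ (g Fin.zero)) (∑-cong (allFin n) (λ j → cong (_* g (Fin.suc j)) (indicator-suc i j))) ⟩
  0ℚ + Σ[V] (λ j → indicator i j * g (Fin.suc j))                        ≡⟨ ℚ.+-identityˡ _ ⟩
  Σ[V] (λ j → indicator i j * g (Fin.suc j))                             ≡⟨ Σ[V]-indicator i (λ j → g (Fin.suc j)) ⟩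
  g (Fin.suc i)                                                          ∎
  where open ≡-Reasoning

≤-Σ[V] : ∀ {n} (f : Vecℚ n) → (∀ j → 0ℚ ≤ℚ f j) → ∀ i → f i ≤ℚ Σ[V] f
≤-Σ[V] {n} f 0≤f i = subst (_≤ℚ Σ[V] f) (Σ[V]-indicator i f) (∑-mono-≤ (allFin n) indicator*f≤f)
  where
  indicator*f≤f : ∀ j → indicator i j * f j ≤ℚ f j
  indicator*f≤f j with i ≟ j
  ... | yes _ = ℚ.≤-reflexive (ℚ.*-identityˡ (f j))
  ... | no  _ = subst (_≤ℚ f j) (sym (ℚ.*-zeroˡ (f j))) (0≤f j)

∑-cauchy-schwarz : ∀ {X : Set} (l : List X) (f g : X → ℚ) →
                   ∑[ x ∈ l ] (f x * g x) * ∑[ x ∈ l ] (f x * g x) ≤ℚ ∑[ x ∈ l ] (f x * f x) * ∑[ x ∈ l ] (g x * g x)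
∑-cauchy-schwarz l f g = begin
  s * s                        ≡⟨ halve (s * s) ⟨
  ½ * (s * s + s * s)          ≤⟨ *-monoˡ-≤-0≤ 0≤½ (≤-+-nonNeg (s * s + s * s) Δ-nonNeg) ⟩
  ½ * (s * s + s * s + Δ)      ≡⟨ cong (½ *_) lagrange ⟩
  ½ * (F * G + G * F)          ≡⟨ cong (λ z → ½ * (F * G + z)) (ℚ.*-comm G F) ⟩
  ½ * (F * G + F * G)          ≡⟨ halve (F * G) ⟩
  F * G                        ∎
  where
  open ℚ.≤-Reasoning
  s F G Δ : ℚ
  s = ∑[ x ∈ l ] (f x * g x)
  F = ∑[ x ∈ l ] (f x * f x)
  G = ∑[ x ∈ l ] (g x * g x)
  Δ = ∑[ x ∈ l ] ∑[ y ∈ l ] ((f x * g y - f y * g x) * (f x * g y - f y * g x))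

  Δ-nonNeg : 0ℚ ≤ℚ Δ
  Δ-nonNeg = ∑-nonNeg l (λ x → ∑-nonNeg l (λ y → *-self-nonNeg (f x * g y - f y * g x)))

  halve : ∀ p → ½ * (p + p) ≡ p
  halve = solve 1 (λ p → con ½ :* (p :+ p) := p) refl

  lagrange-term : ∀ a b c d → (a * b) * (c * d) + (a * b) * (c * d) + (a * d - c * b) * (a * d - c * b)
                              ≡ (a * a) * (d * d) + (b * b) * (c * c)
  lagrange-term = solve 4 (λ a b c d → (a :* b) :* (c :* d) :+ (a :* b) :* (c :* d) :+ (a :* d :- c :* b) :* (a :* d :- c :* b) := (a :* a) :* (d :* d) :+ (b :* b) :* (c :* c)) refl

  lagrange : s * s + s * s + Δ ≡ F * G + G * F
  lagrange = begin-equality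
    s * s + s * s + Δ
      ≡⟨ cong (λ z → z + z + Δ) (∑-*-∑ l l (λ x → f x * g x) (λ y → f y * g y)) ⟩
    ∑[ x ∈ l ] ∑[ y ∈ l ] ((f x * g x) * (f y * g y)) + ∑[ x ∈ l ] ∑[ y ∈ l ] ((f x * g x) * (f y * g y)) + Δ
      ≡⟨ cong (_+ Δ) (∑∑-+ l _ _) ⟨
    ∑[ x ∈ l ] ∑[ y ∈ l ] ((f x * g x) * (f y * g y) + (f x * g x) * (f y * g y)) + Δ
      ≡⟨ ∑∑-+ l _ _ ⟨
    ∑[ x ∈ l ] ∑[ y ∈ l ] ((f x * g x) * (f y * g y) + (f x * g x) * (f y * g y) + (f x * g y - f y * g x) * (f x * g y - f y * g x))
      ≡⟨ ∑-cong l (λ x → ∑-cong l (λ y → lagrange-term (f x) (g x) (f y) (g y))) ⟩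
    ∑[ x ∈ l ] ∑[ y ∈ l ] ((f x * f x) * (g y * g y) + (g x * g x) * (f y * f y))
      ≡⟨ ∑∑-+ l _ _ ⟩
    ∑[ x ∈ l ] ∑[ y ∈ l ] ((f x * f x) * (g y * g y)) + ∑[ x ∈ l ] ∑[ y ∈ l ] ((g x * g x) * (f y * f y))
      ≡⟨ cong₂ _+_ (∑-*-∑ l l (λ x → f x * f x) (λ y → g y * g y)) (∑-*-∑ l l (λ x → g x * g x) (λ y → f y * f y)) ⟨
    F * G + G * F ∎

module _ {n : ℕ} {a : ℚ} (0≤a : 0ℚ ≤ℚ a) where

  entry≤ : (u : Vecℚ n) → normSq u ≤ℚ a * a → ∀ i → u i ≤ℚ a
  entry≤ u ‖u‖²≤a² i = *-self-≤⇒≤ 0≤a (ℚ.≤-trans (≤-Σ[V] (λ j → u j * u j) (λ j → *-self-nonNeg (u j)) i) ‖u‖²≤a²)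

  inner≤ : ∀ {b} → 0ℚ ≤ℚ b → (u v : Vecℚ n) → normSq u ≤ℚ a * a → normSq v ≤ℚ b * b → inner u v ≤ℚ a * b
  inner≤ {b} 0≤b u v ‖u‖²≤a² ‖v‖²≤b² = *-self-≤⇒≤ (*-nonNeg 0≤a 0≤b) (begin
    inner u v * inner u v    ≤⟨ ∑-cauchy-schwarz (allFin n) u v ⟩
    normSq u * normSq v      ≤⟨ *-monoʳ-≤-0≤ (∑-nonNeg (allFin n) (λ j → *-self-nonNeg (v j))) ‖u‖²≤a² ⟩
    (a * a) * normSq v       ≤⟨ *-monoˡ-≤-0≤ (*-self-nonNeg a) ‖v‖²≤b² ⟩
    (a * a) * (b * b)        ≡⟨ square-of-product a b ⟩
    (a * b) * (a * b)        ∎)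
    where
    open ℚ.≤-Reasoning
    square-of-product : ∀ a b → (a * a) * (b * b) ≡ (a * b) * (a * b)
    square-of-product = solve 2 (λ a b → (a :* a) :* (b :* b) := (a :* b) :* (a :* b)) refl

-- Expectations over finite distributions

E : {X : Set} → Dist X → (X → ℚ) → ℚ
E []            f = 0ℚ
E ((p , a) ∷ μ) f = p * f a + E μ f

mass : {X : Set} → Dist X → ℚ
mass μ = E μ (λ _ → 1ℚ)

𝔼-mapD : ∀ {X : Set} (f : X → ℚ) (μ : Dist X) → 𝔼 (mapD f μ) ≡ E μ f
𝔼-mapD f []            = refl
𝔼-mapD f ((p , a) ∷ μ) = cong (p * f a +_) (𝔼-mapD f μ)

𝔼≡E : ∀ (μ : Dist ℚ) → 𝔼 μ ≡ E μ (λ z → z)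
𝔼≡E []            = refl
𝔼≡E ((p , z) ∷ μ) = cong (p * z +_) (𝔼≡E μ)

module _ {X : Set} where

  E-cong : ∀ (μ : Dist X) {f g : X → ℚ} → (∀ a → f a ≡ g a) → E μ f ≡ E μ g
  E-cong []            f≗g = refl
  E-cong ((p , a) ∷ μ) f≗g = cong₂ (λ u v → p * u + v) (f≗g a) (E-cong μ f≗g)

  E-+ : ∀ (μ : Dist X) (f g : X → ℚ) → E μ (λ a → f a + g a) ≡ E μ f + E μ g
  E-+ []            f g = sym (ℚ.+-identityˡ 0ℚ)
  E-+ ((p , a) ∷ μ) f g = trans (cong (p * (f a + g a) +_) (E-+ μ f g)) (distrib p (f a) (g a) (E μ f) (E μ g))
    where
    distrib : ∀ p x y u v → p * (x + y) + (u + v) ≡ (p * x + u) + (p * y + v)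
    distrib = solve 5 (λ p x y u v → p :* (x :+ y) :+ (u :+ v) := (p :* x :+ u) :+ (p :* y :+ v)) refl

  E-*ˡ : ∀ (μ : Dist X) (c : ℚ) (f : X → ℚ) → E μ (λ a → c * f a) ≡ c * E μ f
  E-*ˡ []            c f = sym (ℚ.*-zeroʳ c)
  E-*ˡ ((p , a) ∷ μ) c f = trans (cong (p * (c * f a) +_) (E-*ˡ μ c f)) (factor p c (f a) (E μ f))
    where
    factor : ∀ p c x u → p * (c * x) + c * u ≡ c * (p * x + u)
    factor = solve 4 (λ p c x u → p :* (c :* x) :+ c :* u := c :* (p :* x :+ u)) refl

  E-*ʳ : ∀ (μ : Dist X) (c : ℚ) (f : X → ℚ) → E μ (λ a → f a * c) ≡ E μ f * c
  E-*ʳ μ c f = trans (E-cong μ (λ a → ℚ.*-comm (f a) c)) (trans (E-*ˡ μ c f) (ℚ.*-comm c (E μ f)))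

  E-const : ∀ (μ : Dist X) → mass μ ≡ 1ℚ → ∀ c → E μ (λ _ → c) ≡ c
  E-const μ mass≡1 c = begin
    E μ (λ _ → c)          ≡⟨ E-cong μ (λ _ → ℚ.*-identityʳ c) ⟨
    E μ (λ _ → c * 1ℚ)     ≡⟨ E-*ˡ μ c (λ _ → 1ℚ) ⟩
    c * mass μ             ≡⟨ cong (c *_) mass≡1 ⟩
    c * 1ℚ                 ≡⟨ ℚ.*-identityʳ c ⟩
    c                      ∎
    where open ≡-Reasoning

  E-∑ : ∀ {I : Set} (μ : Dist X) (l : List I) (h : I → X → ℚ) →
        E μ (λ a → ∑[ i ∈ l ] h i a) ≡ ∑[ i ∈ l ] E μ (h i)
  E-∑ μ []      h = trans (E-cong μ (λ _ → sym (ℚ.*-zeroˡ 0ℚ))) (trans (E-*ˡ μ 0ℚ (λ _ → 0ℚ)) (ℚ.*-zeroˡ (E μ (λ _ → 0ℚ))))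
  E-∑ μ (i ∷ l) h = trans (E-+ μ (h i) (λ a → ∑[ j ∈ l ] h j a)) (cong (E μ (h i) +_) (E-∑ μ l h))

  E-pure : ∀ (x : X) (f : X → ℚ) → E (pure x) f ≡ f x
  E-pure x f = trans (ℚ.+-identityʳ (1ℚ * f x)) (ℚ.*-identityˡ (f x))

  E-++ : ∀ (μ ν : Dist X) (f : X → ℚ) → E (μ ++ ν) f ≡ E μ f + E ν f
  E-++ []            ν f = sym (ℚ.+-identityˡ (E ν f))
  E-++ ((p , a) ∷ μ) ν f = trans (cong (p * f a +_) (E-++ μ ν f)) (sym (ℚ.+-assoc (p * f a) (E μ f) (E ν f)))

  E-mapD : ∀ {Y : Set} (g : X → Y) (f : Y → ℚ) (μ : Dist X) → E (mapD g μ) f ≡ E μ (λ a → f (g a))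
  E-mapD g f []            = refl
  E-mapD g f ((p , a) ∷ μ) = cong (p * f (g a) +_) (E-mapD g f μ)

E-bind : ∀ {X Y : Set} (μ : Dist X) (k : X → Dist Y) (f : Y → ℚ) → E (bind μ k) f ≡ E μ (λ a → E (k a) f)
E-bind []            k f = refl
E-bind {Y = Y} ((p , a) ∷ μ) k f = trans (E-++ (scaled (k a)) (bind μ k) f) (cong₂ _+_ (E-scaled (k a)) (E-bind μ k f))
  where
  scaled : Dist Y → Dist Y
  scaled ν = map (λ { (q , b) → (p * q , b) }) ν
  E-scaled : ∀ ν → E (scaled ν) f ≡ p * E ν f
  E-scaled []            = sym (ℚ.*-zeroʳ p)
  E-scaled ((q , b) ∷ ν) = trans (cong ((p * q) * f b +_) (E-scaled ν)) (assoc-distrib p q (f b) (E ν f))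
    where
    assoc-distrib : ∀ p q x u → (p * q) * x + p * u ≡ p * (q * x + u)
    assoc-distrib = solve 4 (λ p q x u → (p :* q) :* x :+ p :* u := p :* (q :* x :+ u)) refl

-- Independent samples

E₂ : {X Y : Set} → Dist X → Dist Y → (X → Y → ℚ) → ℚ
E₂ μ ν h = E μ (λ a → E ν (h a))

module _ {X Y : Set} (μ : Dist X) (ν : Dist Y) where

  E₂-cong : ∀ {h h′ : X → Y → ℚ} → (∀ a b → h a b ≡ h′ a b) → E₂ μ ν h ≡ E₂ μ ν h′
  E₂-cong h≗h′ = E-cong μ (λ a → E-cong ν (h≗h′ a))

  E₂-+ : ∀ (h h′ : X → Y → ℚ) → E₂ μ ν (λ a b → h a b + h′ a b) ≡ E₂ μ ν h + E₂ μ ν h′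
  E₂-+ h h′ = trans (E-cong μ (λ a → E-+ ν (h a) (h′ a))) (E-+ μ (λ a → E ν (h a)) (λ a → E ν (h′ a)))

  E₂-∑ : ∀ {I : Set} (l : List I) (h : I → X → Y → ℚ) →
         E₂ μ ν (λ a b → ∑[ i ∈ l ] h i a b) ≡ ∑[ i ∈ l ] E₂ μ ν (h i)
  E₂-∑ l h = trans (E-cong μ (λ a → E-∑ ν l (λ i → h i a))) (E-∑ μ l (λ i a → E ν (h i a)))

  E₂-* : ∀ (u : X → ℚ) (v : Y → ℚ) → E₂ μ ν (λ a b → u a * v b) ≡ E μ u * E ν v
  E₂-* u v = trans (E-cong μ (λ a → E-*ˡ ν (u a) v)) (E-*ʳ μ (E ν v) u)

  E₂-fst : mass ν ≡ 1ℚ → ∀ (u : X → ℚ) → E₂ μ ν (λ a _ → u a) ≡ E μ u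
  E₂-fst mass≡1 u = E-cong μ (λ a → E-const ν mass≡1 (u a))

  E₂-snd : mass μ ≡ 1ℚ → ∀ (v : Y → ℚ) → E₂ μ ν (λ _ b → v b) ≡ E ν v
  E₂-snd mass≡1 v = E-const μ mass≡1 (E ν v)

E₂-+*+ : ∀ {X Y : Set} (μ : Dist X) (ν : Dist Y) → mass μ ≡ 1ℚ → mass ν ≡ 1ℚ →
         ∀ (u u′ : X → ℚ) (v v′ : Y → ℚ) →
         E₂ μ ν (λ a b → (u a + v b) * (u′ a + v′ b))
           ≡ E μ (λ a → u a * u′ a) + (E μ u * E ν v′ + (E μ u′ * E ν v + E ν (λ b → v b * v′ b)))
E₂-+*+ μ ν mass-μ mass-ν u u′ v v′ = begin
  E₂ μ ν (λ a b → (u a + v b) * (u′ a + v′ b))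
    ≡⟨ E₂-cong μ ν (λ a b → expand (u a) (u′ a) (v b) (v′ b)) ⟩
  E₂ μ ν (λ a b → u a * u′ a + (u a * v′ b + (u′ a * v b + v b * v′ b)))
    ≡⟨ E₂-+ μ ν (λ a _ → u a * u′ a) (λ a b → u a * v′ b + (u′ a * v b + v b * v′ b)) ⟩
  E₂ μ ν (λ a _ → u a * u′ a) + E₂ μ ν (λ a b → u a * v′ b + (u′ a * v b + v b * v′ b))
    ≡⟨ cong (E₂ μ ν (λ a _ → u a * u′ a) +_) (E₂-+ μ ν (λ a b → u a * v′ b) (λ a b → u′ a * v b + v b * v′ b)) ⟩
  E₂ μ ν (λ a _ → u a * u′ a) + (E₂ μ ν (λ a b → u a * v′ b) + E₂ μ ν (λ a b → u′ a * v b + v b * v′ b))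
    ≡⟨ cong (λ z → E₂ μ ν (λ a _ → u a * u′ a) + (E₂ μ ν (λ a b → u a * v′ b) + z)) (E₂-+ μ ν (λ a b → u′ a * v b) (λ _ b → v b * v′ b)) ⟩
  E₂ μ ν (λ a _ → u a * u′ a) + (E₂ μ ν (λ a b → u a * v′ b) + (E₂ μ ν (λ a b → u′ a * v b) + E₂ μ ν (λ _ b → v b * v′ b)))
    ≡⟨ cong₂ _+_ (E₂-fst μ ν mass-ν (λ a → u a * u′ a))
                 (cong₂ _+_ (E₂-* μ ν u v′) (cong₂ _+_ (E₂-* μ ν u′ v) (E₂-snd μ ν mass-μ (λ b → v b * v′ b)))) ⟩
  E μ (λ a → u a * u′ a) + (E μ u * E ν v′ + (E μ u′ * E ν v + E ν (λ b → v b * v′ b))) ∎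
  where
  open ≡-Reasoning
  expand : ∀ x x′ y y′ → (x + y) * (x′ + y′) ≡ x * x′ + (x * y′ + (x′ * y + y * y′))
  expand = solve 4 (λ x x′ y y′ → (x :+ y) :* (x′ :+ y′) := x :* x′ :+ (x :* y′ :+ (x′ :* y :+ y :* y′))) refl

E-iid-suc : ∀ {X : Set} (μ : Dist X) k (f : List X → ℚ) →
            E (iid (suc k) μ) f ≡ E₂ μ (iid k μ) (λ a ws → f (a ∷ ws))
E-iid-suc μ k f = trans (E-bind μ (λ a → mapD (a ∷_) (iid k μ)) f) (E-cong μ (λ a → E-mapD (a ∷_) f (iid k μ)))

module _ {X : Set} {μ : Dist X} (mass≡1 : mass μ ≡ 1ℚ) where

  mass-iid : ∀ k → mass (iid k μ) ≡ 1ℚ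
  mass-iid zero    = E-pure {List X} [] (λ _ → 1ℚ)
  mass-iid (suc k) = trans (E-iid-suc μ k (λ _ → 1ℚ)) (trans (E₂-fst μ (iid k μ) (mass-iid k) (λ _ → 1ℚ)) mass≡1)

  E-iid-∑ : ∀ k (f : X → ℚ) → E (iid k μ) (λ ws → ∑ ws f) ≡ ℕ→ℚ k * E μ f
  E-iid-∑ zero    f = trans (E-pure {List X} [] (λ ws → ∑ ws f)) (sym (ℚ.*-zeroˡ (E μ f)))
  E-iid-∑ (suc k) f = begin
    E (iid (suc k) μ) (λ ws → ∑ ws f)                          ≡⟨ E-iid-suc μ k (λ ws → ∑ ws f) ⟩
    E₂ μ (iid k μ) (λ a ws → f a + ∑ ws f)                     ≡⟨ E₂-+ μ (iid k μ) (λ a _ → f a) (λ _ ws → ∑ ws f) ⟩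
    E₂ μ (iid k μ) (λ a _ → f a) + E₂ μ (iid k μ) (λ _ ws → ∑ ws f)
      ≡⟨ cong₂ _+_ (E₂-fst μ (iid k μ) (mass-iid k) f) (trans (E₂-snd μ (iid k μ) mass≡1 (λ ws → ∑ ws f)) (E-iid-∑ k f)) ⟩
    E μ f + ℕ→ℚ k * E μ f                                      ≡⟨ factor (E μ f) (ℕ→ℚ k) ⟩
    (1ℚ + ℕ→ℚ k) * E μ f                                       ≡⟨ cong (_* E μ f) (ℕ→ℚ-suc k) ⟨
    ℕ→ℚ (suc k) * E μ f                                        ∎
    where
    open ≡-Reasoning
    factor : ∀ e K → e + K * e ≡ (1ℚ + K) * e
    factor = solve 2 (λ e K → e :+ K :* e := (con 1ℚ :+ K) :* e) refl

  E-iid-∑*∑ : ∀ k (f g : X → ℚ) →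
              E (iid k μ) (λ ws → ∑ ws f * ∑ ws g)
                ≡ ℕ→ℚ k * E μ (λ a → f a * g a) + (ℕ→ℚ k * ℕ→ℚ k - ℕ→ℚ k) * (E μ f * E μ g)
  E-iid-∑*∑ zero    f g = trans (E-pure {List X} [] (λ ws → ∑ ws f * ∑ ws g)) (no-samples (E μ (λ a → f a * g a)) (E μ f * E μ g))
    where
    no-samples : ∀ x y → 0ℚ * 0ℚ ≡ 0ℚ * x + (0ℚ * 0ℚ - 0ℚ) * y
    no-samples = solve 2 (λ x y → con 0ℚ :* con 0ℚ := con 0ℚ :* x :+ (con 0ℚ :* con 0ℚ :- con 0ℚ) :* y) refl
  E-iid-∑*∑ (suc k) f g = begin
    E (iid (suc k) μ) (λ ws → ∑ ws f * ∑ ws g)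
      ≡⟨ E-iid-suc μ k (λ ws → ∑ ws f * ∑ ws g) ⟩
    E₂ μ (iid k μ) (λ a ws → (f a + ∑ ws f) * (g a + ∑ ws g))
      ≡⟨ E₂-+*+ μ (iid k μ) mass≡1 (mass-iid k) f g (λ ws → ∑ ws f) (λ ws → ∑ ws g) ⟩
    x + (E μ f * E (iid k μ) (λ ws → ∑ ws g) + (E μ g * E (iid k μ) (λ ws → ∑ ws f) + E (iid k μ) (λ ws → ∑ ws f * ∑ ws g)))
      ≡⟨ cong₂ (λ u v → x + (E μ f * u + v)) (E-iid-∑ k g) (cong₂ (λ u v → E μ g * u + v) (E-iid-∑ k f) (E-iid-∑*∑ k f g)) ⟩
    x + (E μ f * (K * E μ g) + (E μ g * (K * E μ f) + (K * x + (K * K - K) * y)))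
      ≡⟨ collect K x (E μ f) (E μ g) ⟩
    (1ℚ + K) * x + ((1ℚ + K) * (1ℚ + K) - (1ℚ + K)) * y
      ≡⟨ cong (λ K′ → K′ * x + (K′ * K′ - K′) * y) (ℕ→ℚ-suc k) ⟨
    ℕ→ℚ (suc k) * x + (ℕ→ℚ (suc k) * ℕ→ℚ (suc k) - ℕ→ℚ (suc k)) * y ∎
    where
    open ≡-Reasoning
    K x y : ℚ
    K = ℕ→ℚ k
    x = E μ (λ a → f a * g a)
    y = E μ f * E μ g
    collect : ∀ K m u v → m + (u * (K * v) + (v * (K * u) + (K * m + (K * K - K) * (u * v))))
                          ≡ (1ℚ + K) * m + ((1ℚ + K) * (1ℚ + K) - (1ℚ + K)) * (u * v)
    collect = solve 4 (λ K m u v → m :+ (u :* (K :* v) :+ (v :* (K :* u) :+ (K :* m :+ (K :* K :- K) :* (u :* v)))) := (con 1ℚ :+ K) :* m :+ ((con 1ℚ :+ K) :* (con 1ℚ :+ K) :- (con 1ℚ :+ K)) :* (u :* v)) refl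

  module _ (k : ℕ) .{{_ : NonZero k}} where

    E-iid-mean : ∀ (f : X → ℚ) → E (iid k μ) (λ ws → inv k * ∑ ws f) ≡ E μ f
    E-iid-mean f = begin
      E (iid k μ) (λ ws → inv k * ∑ ws f)   ≡⟨ E-*ˡ (iid k μ) (inv k) (λ ws → ∑ ws f) ⟩
      inv k * E (iid k μ) (λ ws → ∑ ws f)   ≡⟨ cong (inv k *_) (E-iid-∑ k f) ⟩
      inv k * (ℕ→ℚ k * E μ f)               ≡⟨ ℚ.*-assoc (inv k) (ℕ→ℚ k) (E μ f) ⟨
      (inv k * ℕ→ℚ k) * E μ f               ≡⟨ cong (_* E μ f) (inv-inverseˡ k) ⟩
      1ℚ * E μ f                            ≡⟨ ℚ.*-identityˡ (E μ f) ⟩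
      E μ f                                 ∎
      where open ≡-Reasoning

    E-iid-mean*mean : ∀ (f g : X → ℚ) →
                      E (iid k μ) (λ ws → (inv k * ∑ ws f) * (inv k * ∑ ws g))
                        ≡ inv k * E μ (λ a → f a * g a) + (1ℚ - inv k) * (E μ f * E μ g)
    E-iid-mean*mean f g = begin
      E (iid k μ) (λ ws → (m * ∑ ws f) * (m * ∑ ws g))
        ≡⟨ E-cong (iid k μ) (λ ws → regroup m (∑ ws f) (∑ ws g)) ⟩
      E (iid k μ) (λ ws → (m * m) * (∑ ws f * ∑ ws g))
        ≡⟨ E-*ˡ (iid k μ) (m * m) (λ ws → ∑ ws f * ∑ ws g) ⟩
      (m * m) * E (iid k μ) (λ ws → ∑ ws f * ∑ ws g)
        ≡⟨ cong ((m * m) *_) (E-iid-∑*∑ k f g) ⟩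
      (m * m) * (K * x + (K * K - K) * y)
        ≡⟨ through-mK m K x y ⟩
      m * (m * K) * x + ((m * K) * (m * K) - m * (m * K)) * y
        ≡⟨ cong (λ e → m * e * x + (e * e - m * e) * y) (inv-inverseˡ k) ⟩
      m * 1ℚ * x + (1ℚ * 1ℚ - m * 1ℚ) * y
        ≡⟨ unit m x y ⟩
      m * x + (1ℚ - m) * y ∎
      where
      open ≡-Reasoning
      m K x y : ℚ
      m = inv k
      K = ℕ→ℚ k
      x = E μ (λ a → f a * g a)
      y = E μ f * E μ g
      regroup : ∀ m u v → (m * u) * (m * v) ≡ (m * m) * (u * v)
      regroup = solve 3 (λ m u v → (m :* u) :* (m :* v) := (m :* m) :* (u :* v)) refl
      through-mK : ∀ m K x y → (m * m) * (K * x + (K * K - K) * y) ≡ m * (m * K) * x + ((m * K) * (m * K) - m * (m * K)) * y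
      through-mK = solve 4 (λ m K x y → (m :* m) :* (K :* x :+ (K :* K :- K) :* y) := m :* (m :* K) :* x :+ ((m :* K) :* (m :* K) :- m :* (m :* K)) :* y) refl
      unit : ∀ m x y → m * 1ℚ * x + (1ℚ * 1ℚ - m * 1ℚ) * y ≡ m * x + (1ℚ - m) * y
      unit = solve 3 (λ m x y → m :* con 1ℚ :* x :+ (con 1ℚ :* con 1ℚ :- m :* con 1ℚ) :* y := m :* x :+ (con 1ℚ :- m) :* y) refl

sampleMean : ℕ → Dist ℚ → Dist ℚ
sampleMean k ν = mapD (λ zs → inv k * sumℚ zs) (iid k ν)

module _ {ν : Dist ℚ} (mass≡1 : mass ν ≡ 1ℚ) (k : ℕ) .{{_ : NonZero k}} where

  private
    sumℚ≡∑ : ∀ zs → sumℚ zs ≡ ∑[ z ∈ zs ] z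
    sumℚ≡∑ zs = cong sumℚ (sym (List.map-id zs))

  𝔼-sampleMean : 𝔼 (sampleMean k ν) ≡ 𝔼 ν
  𝔼-sampleMean = begin
    𝔼 (sampleMean k ν)                               ≡⟨ 𝔼-mapD (λ zs → inv k * sumℚ zs) (iid k ν) ⟩
    E (iid k ν) (λ zs → inv k * sumℚ zs)             ≡⟨ E-cong (iid k ν) (λ zs → cong (inv k *_) (sumℚ≡∑ zs)) ⟩
    E (iid k ν) (λ zs → inv k * ∑[ z ∈ zs ] z)       ≡⟨ E-iid-mean mass≡1 k (λ z → z) ⟩
    E ν (λ z → z)                                    ≡⟨ 𝔼≡E ν ⟨
    𝔼 ν                                              ∎
    where open ≡-Reasoning

  Var-sampleMean : Var (sampleMean k ν) ≡ inv k * Var ν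
  Var-sampleMean = begin
    Var (sampleMean k ν)                             ≡⟨ cong₂ (λ u v → u - v * v) 𝔼-square 𝔼-sampleMean ⟩
    m * 𝔼 (mapD (λ z → z * z) ν) + (1ℚ - m) * (𝔼 ν * 𝔼 ν) - 𝔼 ν * 𝔼 ν
                                                     ≡⟨ factor m (𝔼 (mapD (λ z → z * z) ν)) (𝔼 ν * 𝔼 ν) ⟩
    m * Var ν                                        ∎
    where
    open ≡-Reasoning
    m : ℚ
    m = inv k
    factor : ∀ m x y → m * x + (1ℚ - m) * y - y ≡ m * (x - y)
    factor = solve 3 (λ m x y → m :* x :+ (con 1ℚ :- m) :* y :- y := m :* (x :- y)) refl
    𝔼-square : 𝔼 (mapD (λ z → z * z) (sampleMean k ν)) ≡ m * 𝔼 (mapD (λ z → z * z) ν) + (1ℚ - m) * (𝔼 ν * 𝔼 ν)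
    𝔼-square = begin
      𝔼 (mapD (λ z → z * z) (sampleMean k ν))
        ≡⟨ trans (𝔼-mapD (λ z → z * z) (sampleMean k ν)) (E-mapD (λ zs → m * sumℚ zs) (λ z → z * z) (iid k ν)) ⟩
      E (iid k ν) (λ zs → (m * sumℚ zs) * (m * sumℚ zs))
        ≡⟨ E-cong (iid k ν) (λ zs → cong (λ s → (m * s) * (m * s)) (sumℚ≡∑ zs)) ⟩
      E (iid k ν) (λ zs → (m * ∑[ z ∈ zs ] z) * (m * ∑[ z ∈ zs ] z))
        ≡⟨ E-iid-mean*mean mass≡1 k (λ z → z) (λ z → z) ⟩
      m * E ν (λ z → z * z) + (1ℚ - m) * (E ν (λ z → z) * E ν (λ z → z))
        ≡⟨ cong₂ (λ u v → m * u + (1ℚ - m) * (v * v)) (𝔼-mapD (λ z → z * z) ν) (𝔼≡E ν) ⟨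
      m * 𝔼 (mapD (λ z → z * z) ν) + (1ℚ - m) * (𝔼 ν * 𝔼 ν) ∎

-- The lazy random walk

density : ∀ {n} → Dist (Fin n) → Vecℚ n
density μ i = E μ (λ w → indicator w i)

E≡Σ[V]density : ∀ {n} (μ : Dist (Fin n)) (f : Vecℚ n) → E μ f ≡ Σ[V] (λ v → density μ v * f v)
E≡Σ[V]density {n} []            f = sym (trans (∑-*ˡ (allFin n) 0ℚ f) (ℚ.*-zeroˡ (Σ[V] f)))
E≡Σ[V]density {n} ((p , a) ∷ μ) f = begin
  p * f a + E μ f
    ≡⟨ cong₂ (λ u v → p * u + v) (Σ[V]-indicator a f) (sym (E≡Σ[V]density μ f)) ⟨
  p * Σ[V] (λ v → indicator a v * f v) + Σ[V] (λ v → density μ v * f v)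
    ≡⟨ cong (_+ Σ[V] (λ v → density μ v * f v)) (∑-*ˡ (allFin n) p (λ v → indicator a v * f v)) ⟨
  Σ[V] (λ v → p * (indicator a v * f v)) + Σ[V] (λ v → density μ v * f v)
    ≡⟨ ∑-+ (allFin n) _ _ ⟨
  Σ[V] (λ v → p * (indicator a v * f v) + density μ v * f v)
    ≡⟨ ∑-cong (allFin n) (λ v → distrib p (indicator a v) (density μ v) (f v)) ⟩
  Σ[V] (λ v → density ((p , a) ∷ μ) v * f v) ∎
  where
  open ≡-Reasoning
  distrib : ∀ p δ q x → p * (δ * x) + q * x ≡ (p * δ + q) * x
  distrib = solve 4 (λ p δ q x → p :* (δ :* x) :+ q :* x := (p :* δ :+ q) :* x) refl

∑-const-1 : ∀ {X : Set} (l : List X) → ∑[ _ ∈ l ] 1ℚ ≡ ℕ→ℚ (length l)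
∑-const-1 []      = refl
∑-const-1 (x ∷ l) = trans (cong (1ℚ +_) (∑-const-1 l)) (sym (ℕ→ℚ-suc (length l)))

module _ {n : ℕ} (A : Adj n) (d : ℕ) where

  E-lazyStep : ∀ v (g : Vecℚ n) → E (lazyStep A d v) g ≡ ½ * g v + (½ * inv d) * ∑ (nbrs A v) g
  E-lazyStep v g = cong (½ * g v +_) (trans (E-moves (nbrs A v)) (∑-*ˡ (nbrs A v) (½ * inv d) g))
    where
    E-moves : ∀ ws → E (map (λ w → (½ * inv d , w)) ws) g ≡ ∑[ w ∈ ws ] ((½ * inv d) * g w)
    E-moves []       = refl
    E-moves (w ∷ ws) = cong ((½ * inv d) * g w +_) (E-moves ws)

  mass-walk : IsRegular A d → .{{NonZero d}} → ∀ t x → mass (walk A d t x) ≡ 1ℚ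
  mass-walk regular zero    x = E-pure x (λ _ → 1ℚ)
  mass-walk regular (suc t) x = begin
    mass (walk A d (suc t) x)                      ≡⟨ E-bind (walk A d t x) (lazyStep A d) (λ _ → 1ℚ) ⟩
    E (walk A d t x) (λ v → mass (lazyStep A d v)) ≡⟨ E-cong (walk A d t x) mass-lazyStep ⟩
    mass (walk A d t x)                            ≡⟨ mass-walk regular t x ⟩
    1ℚ                                             ∎
    where
    open ≡-Reasoning
    mass-lazyStep : ∀ v → mass (lazyStep A d v) ≡ 1ℚ
    mass-lazyStep v = begin
      mass (lazyStep A d v)                                  ≡⟨ E-lazyStep v (λ _ → 1ℚ) ⟩
      ½ * 1ℚ + (½ * inv d) * ∑[ _ ∈ nbrs A v ] 1ℚ            ≡⟨ cong (λ z → ½ * 1ℚ + (½ * inv d) * z) (trans (∑-const-1 (nbrs A v)) (cong ℕ→ℚ (regular v))) ⟩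
      ½ * 1ℚ + (½ * inv d) * ℕ→ℚ d                           ≡⟨ cong (½ * 1ℚ +_) (ℚ.*-assoc ½ (inv d) (ℕ→ℚ d)) ⟩
      ½ * 1ℚ + ½ * (inv d * ℕ→ℚ d)                           ≡⟨ cong (λ e → ½ * 1ℚ + ½ * e) (inv-inverseˡ d) ⟩
      ½ * 1ℚ + ½ * 1ℚ                                        ≡⟨⟩
      1ℚ                                                     ∎

  -- A step moves v to i with weight 𝟙[ A v i ], whereas applyM sums over the neighbours of i, i.e.
  -- reads 𝟙[ A i v ]: symmetry of A is what identifies the two.
  density-walk : (∀ i j → A i j ≡ A j i) → ∀ t x → ∀ i → density (walk A d t x) i ≡ powM A d t (indicator x) i
  density-walk A-sym zero    x i = E-pure x (λ w → indicator w i)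
  density-walk A-sym (suc t) x i = begin
    E (walk A d (suc t) x) (λ w → indicator w i)
      ≡⟨ E-bind μ (lazyStep A d) (λ w → indicator w i) ⟩
    E μ (λ v → E (lazyStep A d v) (λ w → indicator w i))
      ≡⟨ E-cong μ (λ v → trans (E-lazyStep v (λ w → indicator w i)) (cong (λ z → ½ * indicator v i + c * z) (∑-nbrs-indicator v))) ⟩
    E μ (λ v → ½ * indicator v i + c * 𝟙[ A i v ])
      ≡⟨ trans (E-+ μ _ _) (cong₂ _+_ (E-*ˡ μ ½ (λ v → indicator v i)) (E-*ˡ μ c (λ v → 𝟙[ A i v ]))) ⟩
    ½ * density μ i + c * E μ (λ v → 𝟙[ A i v ])
      ≡⟨ cong₂ (λ u w → ½ * u + c * w) (density-walk A-sym t x i) (E≡Σ[V]density μ (λ v → 𝟙[ A i v ])) ⟩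
    ½ * P i + c * Σ[V] (λ v → density μ v * 𝟙[ A i v ])
      ≡⟨ cong (λ z → ½ * P i + c * z) (∑-cong (allFin n) (λ v → trans (ℚ.*-comm (density μ v) 𝟙[ A i v ]) (cong (𝟙[ A i v ] *_) (density-walk A-sym t x v)))) ⟩
    ½ * P i + c * Σ[V] (λ v → 𝟙[ A i v ] * P v)
      ≡⟨ cong (λ z → ½ * P i + c * z) (∑-filterᵇ (A i) (allFin n) P) ⟨
    powM A d (suc t) (indicator x) i ∎
    where
    open ≡-Reasoning
    μ : Dist (Fin n)
    μ = walk A d t x
    P : Vecℚ n
    P = powM A d t (indicator x)
    c : ℚ
    c = ½ * inv d
    ∑-nbrs-indicator : ∀ v → ∑[ w ∈ nbrs A v ] indicator w i ≡ 𝟙[ A i v ]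
    ∑-nbrs-indicator v = begin
      ∑[ w ∈ nbrs A v ] indicator w i                 ≡⟨ ∑-filterᵇ (A v) (allFin n) (λ w → indicator w i) ⟩
      Σ[V] (λ w → 𝟙[ A v w ] * indicator w i)         ≡⟨ ∑-cong (allFin n) (λ w → trans (ℚ.*-comm 𝟙[ A v w ] (indicator w i)) (cong (_* 𝟙[ A v w ]) (indicator-sym w i))) ⟩
      Σ[V] (λ w → indicator i w * 𝟙[ A v w ])         ≡⟨ Σ[V]-indicator i (λ w → 𝟙[ A v w ]) ⟩
      𝟙[ A v i ]                                      ≡⟨ cong 𝟙[_] (A-sym v i) ⟩
      𝟙[ A i v ]                                      ∎

  powM-nonNeg : ∀ {u : Vecℚ n} → (∀ i → 0ℚ ≤ℚ u i) → ∀ t i → 0ℚ ≤ℚ powM A d t u i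
  powM-nonNeg 0≤u zero    i = 0≤u i
  powM-nonNeg 0≤u (suc t) i = +-nonNeg (*-nonNeg 0≤½ (powM-nonNeg 0≤u t i))
    (*-nonNeg (*-nonNeg 0≤½ (inv-nonNeg d)) (∑-nonNeg (nbrs A i) (powM-nonNeg 0≤u t)))

-- Empirical distributions and the batch statistic

ℕ→ℚ-count : ∀ {n} (i : Fin n) (ws : List (Fin n)) → ℕ→ℚ (count i ws) ≡ ∑[ w ∈ ws ] indicator w i
ℕ→ℚ-count i []       = refl
ℕ→ℚ-count i (w ∷ ws) with w ≟ i
... | yes _ = trans (ℕ→ℚ-suc (count i ws)) (cong (1ℚ +_) (ℕ→ℚ-count i ws))
... | no  _ = trans (ℕ→ℚ-count i ws) (sym (ℚ.+-identityˡ _))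

empiricalMoment : ∀ {n} → ℚ → Vecℚ n → Fin n → Fin n → ℚ
empiricalMoment m p i j = m * (indicator i j * p i) + (1ℚ - m) * (p i * p j)

module _ {n : ℕ} {μ : Dist (Fin n)} (mass≡1 : mass μ ≡ 1ℚ) (M : ℕ) .{{_ : NonZero M}}
         {p : Vecℚ n} (μ≗p : ∀ i → density μ i ≡ p i) where

  private
    empirical≡mean : ∀ (ws : List (Fin n)) i → empirical M ws i ≡ inv M * ∑[ w ∈ ws ] indicator w i
    empirical≡mean ws i = trans (cong (_* inv M) (ℕ→ℚ-count i ws)) (ℚ.*-comm (∑[ w ∈ ws ] indicator w i) (inv M))

  E-empirical : ∀ i → E (iid M μ) (λ ws → empirical M ws i) ≡ p i
  E-empirical i = begin
    E (iid M μ) (λ ws → empirical M ws i)                    ≡⟨ E-cong (iid M μ) (λ ws → empirical≡mean ws i) ⟩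
    E (iid M μ) (λ ws → inv M * ∑[ w ∈ ws ] indicator w i)   ≡⟨ E-iid-mean mass≡1 M (λ w → indicator w i) ⟩
    density μ i                                              ≡⟨ μ≗p i ⟩
    p i                                                      ∎
    where open ≡-Reasoning

  E-empirical* : ∀ i j → E (iid M μ) (λ ws → empirical M ws i * empirical M ws j) ≡ empiricalMoment (inv M) p i j
  E-empirical* i j = begin
    E (iid M μ) (λ ws → empirical M ws i * empirical M ws j)
      ≡⟨ E-cong (iid M μ) (λ ws → cong₂ _*_ (empirical≡mean ws i) (empirical≡mean ws j)) ⟩
    E (iid M μ) (λ ws → (inv M * ∑[ w ∈ ws ] indicator w i) * (inv M * ∑[ w ∈ ws ] indicator w j))
      ≡⟨ E-iid-mean*mean mass≡1 M (λ w → indicator w i) (λ w → indicator w j) ⟩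
    inv M * E μ (λ w → indicator w i * indicator w j) + (1ℚ - inv M) * (density μ i * density μ j)
      ≡⟨ cong (λ z → inv M * z + (1ℚ - inv M) * (density μ i * density μ j))
              (trans (E-cong μ (λ w → indicator-* w i j)) (E-*ˡ μ (indicator i j) (λ w → indicator w i))) ⟩
    inv M * (indicator i j * density μ i) + (1ℚ - inv M) * (density μ i * density μ j)
      ≡⟨ cong₂ (λ u v → inv M * (indicator i j * u) + (1ℚ - inv M) * (u * v)) (μ≗p i) (μ≗p j) ⟩
    empiricalMoment (inv M) p i j ∎
    where open ≡-Reasoning

Σ[V]²-empiricalMoment-* : ∀ {n} (m : ℚ) (p q : Vecℚ n) →
  Σ[V] (λ i → Σ[V] (λ j → empiricalMoment m p i j * empiricalMoment m q i j))
    ≡ Σ[V] (λ i → (p i * q i) * (m * m + m * (1ℚ - m) * (p i + q i) + (1ℚ - m) * (1ℚ - m) * inner p q))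
Σ[V]²-empiricalMoment-* {n} m p q = ∑-cong (allFin n) row
  where
  open ≡-Reasoning
  V : List (Fin n)
  V = allFin n
  s : ℚ
  s = inner p q
  G : Fin n → Fin n → ℚ
  G i j = m * m * (indicator i j * (p i * q i)) + m * (1ℚ - m) * ((p i * q i) * (q j + p j))
  -- δ stays linear in split (δ² is not reduced to δ), so that it is a plain ring identity;
  -- Σ[V]-indicator then evaluates the diagonal.
  split : ∀ m δ a b c e → (m * (δ * a) + (1ℚ - m) * (a * b)) * (m * (δ * c) + (1ℚ - m) * (c * e))
          ≡ δ * (m * m * (δ * (a * c)) + m * (1ℚ - m) * ((a * c) * (e + b))) + ((1ℚ - m) * (1ℚ - m) * (a * c)) * (b * e)
  split = solve 6 (λ m δ a b c e → (m :* (δ :* a) :+ (con 1ℚ :- m) :* (a :* b)) :* (m :* (δ :* c) :+ (con 1ℚ :- m) :* (c :* e)) := δ :* (m :* m :* (δ :* (a :* c)) :+ m :* (con 1ℚ :- m) :* ((a :* c) :* (e :+ b))) :+ ((con 1ℚ :- m) :* (con 1ℚ :- m) :* (a :* c)) :* (b :* e)) refl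
  diagonal : ∀ m a c s → m * m * (1ℚ * (a * c)) + m * (1ℚ - m) * ((a * c) * (c + a)) + ((1ℚ - m) * (1ℚ - m) * (a * c)) * s
             ≡ (a * c) * (m * m + m * (1ℚ - m) * (a + c) + (1ℚ - m) * (1ℚ - m) * s)
  diagonal = solve 4 (λ m a c s → m :* m :* (con 1ℚ :* (a :* c)) :+ m :* (con 1ℚ :- m) :* ((a :* c) :* (c :+ a)) :+ ((con 1ℚ :- m) :* (con 1ℚ :- m) :* (a :* c)) :* s := (a :* c) :* (m :* m :+ m :* (con 1ℚ :- m) :* (a :+ c) :+ (con 1ℚ :- m) :* (con 1ℚ :- m) :* s)) refl
  row : ∀ i → Σ[V] (λ j → empiricalMoment m p i j * empiricalMoment m q i j)
              ≡ (p i * q i) * (m * m + m * (1ℚ - m) * (p i + q i) + (1ℚ - m) * (1ℚ - m) * s)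
  row i = begin
    Σ[V] (λ j → empiricalMoment m p i j * empiricalMoment m q i j)
      ≡⟨ ∑-cong V (λ j → split m (indicator i j) (p i) (p j) (q i) (q j)) ⟩
    Σ[V] (λ j → indicator i j * G i j + ((1ℚ - m) * (1ℚ - m) * (p i * q i)) * (p j * q j))
      ≡⟨ ∑-+ V _ _ ⟩
    Σ[V] (λ j → indicator i j * G i j) + Σ[V] (λ j → ((1ℚ - m) * (1ℚ - m) * (p i * q i)) * (p j * q j))
      ≡⟨ cong₂ _+_ (Σ[V]-indicator i (G i)) (∑-*ˡ V ((1ℚ - m) * (1ℚ - m) * (p i * q i)) (λ j → p j * q j)) ⟩
    G i i + ((1ℚ - m) * (1ℚ - m) * (p i * q i)) * s
      ≡⟨ cong (λ δ → m * m * (δ * (p i * q i)) + m * (1ℚ - m) * ((p i * q i) * (q i + p i)) + ((1ℚ - m) * (1ℚ - m) * (p i * q i)) * s)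
              (indicator-self i) ⟩
    m * m * (1ℚ * (p i * q i)) + m * (1ℚ - m) * ((p i * q i) * (q i + p i)) + ((1ℚ - m) * (1ℚ - m) * (p i * q i)) * s
      ≡⟨ diagonal m (p i) (q i) s ⟩
    (p i * q i) * (m * m + m * (1ℚ - m) * (p i + q i) + (1ℚ - m) * (1ℚ - m) * s) ∎

variance-polynomial-≤ : ∀ {m s a b} → 0ℚ ≤ℚ m → m ≤ℚ 1ℚ → 0ℚ ≤ℚ a → 0ℚ ≤ℚ b → 0ℚ ≤ℚ s → s ≤ℚ a * b →
  s * (m * m + m * (1ℚ - m) * (a + b) + (1ℚ - m) * (1ℚ - m) * s) - s * s ≤ℚ m * (m * (a * b) + (a * (b * b) + (a * a) * b))
variance-polynomial-≤ {m} {s} {a} {b} 0≤m m≤1 0≤a 0≤b 0≤s s≤ab = begin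
  lhs            ≤⟨ ≤-+-nonNeg lhs slack-nonNeg ⟩
  lhs + slack    ≡⟨ add-slack m s a b ⟩
  rhs            ∎
  where
  open ℚ.≤-Reasoning
  lhs slack rhs : ℚ
  lhs = s * (m * m + m * (1ℚ - m) * (a + b) + (1ℚ - m) * (1ℚ - m) * s) - s * s
  slack = m * m * (a * b - s) + m * (a + b) * ((a * b - s) + m * s) + m * ((1ℚ - m) + 1ℚ) * (s * s)
  rhs = m * (m * (a * b) + (a * (b * b) + (a * a) * b))
  add-slack : ∀ m s a b →
    s * (m * m + m * (1ℚ - m) * (a + b) + (1ℚ - m) * (1ℚ - m) * s) - s * s
      + (m * m * (a * b - s) + m * (a + b) * ((a * b - s) + m * s) + m * ((1ℚ - m) + 1ℚ) * (s * s))
    ≡ m * (m * (a * b) + (a * (b * b) + (a * a) * b))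
  add-slack = solve 4 (λ m s a b → s :* (m :* m :+ m :* (con 1ℚ :- m) :* (a :+ b) :+ (con 1ℚ :- m) :* (con 1ℚ :- m) :* s) :- s :* s :+ (m :* m :* (a :* b :- s) :+ m :* (a :+ b) :* ((a :* b :- s) :+ m :* s) :+ m :* ((con 1ℚ :- m) :+ con 1ℚ) :* (s :* s)) := m :* (m :* (a :* b) :+ (a :* (b :* b) :+ (a :* a) :* b))) refl
  0≤ab-s : 0ℚ ≤ℚ a * b - s
  0≤ab-s = p≤q⇒0≤q-p s≤ab
  slack-nonNeg : 0ℚ ≤ℚ slack
  slack-nonNeg = +-nonNeg (+-nonNeg (*-nonNeg (*-nonNeg 0≤m 0≤m) 0≤ab-s)
                                    (*-nonNeg (*-nonNeg 0≤m (+-nonNeg 0≤a 0≤b)) (+-nonNeg 0≤ab-s (*-nonNeg 0≤m 0≤s))))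
                          (*-nonNeg (*-nonNeg 0≤m (+-nonNeg (p≤q⇒0≤q-p m≤1) 0≤1)) (*-self-nonNeg s))

empiricalDot : ∀ {n} → ℕ → Dist (Fin n) → Dist (Fin n) → Dist ℚ
empiricalDot M μx μy =
  bind (iid M μx) (λ wx → bind (iid M μy) (λ wy → pure (inner (empirical M wx) (empirical M wy))))

module EmpiricalDot {n : ℕ} (μx μy : Dist (Fin n)) (mass-μx : mass μx ≡ 1ℚ) (mass-μy : mass μy ≡ 1ℚ) (M : ℕ) .{{_ : NonZero M}}
         {p q : Vecℚ n} (μx≗p : ∀ i → density μx i ≡ p i) (μy≗q : ∀ i → density μy i ≡ q i) where

  private
    V : List (Fin n)
    V = allFin n
    X Y : Dist (List (Fin n))
    X = iid M μx
    Y = iid M μy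
    m : ℚ
    m = inv M

  E-empiricalDot : ∀ f → E (empiricalDot M μx μy) f ≡ E₂ X Y (λ wx wy → f (inner (empirical M wx) (empirical M wy)))
  E-empiricalDot f = trans (E-bind X (λ wx → bind Y (λ wy → pure (Z wx wy))) f)
                           (E-cong X (λ wx → trans (E-bind Y (λ wy → pure (Z wx wy)) f) (E-cong Y (λ wy → E-pure (Z wx wy) f))))
    where
    Z : List (Fin n) → List (Fin n) → ℚ
    Z wx wy = inner (empirical M wx) (empirical M wy)

  mass-empiricalDot : mass (empiricalDot M μx μy) ≡ 1ℚ
  mass-empiricalDot = trans (E-empiricalDot (λ _ → 1ℚ)) (trans (E₂-fst X Y (mass-iid mass-μy M) (λ _ → 1ℚ)) (mass-iid mass-μx M))

  𝔼-empiricalDot : 𝔼 (empiricalDot M μx μy) ≡ inner p q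
  𝔼-empiricalDot = begin
    𝔼 (empiricalDot M μx μy)
      ≡⟨ trans (𝔼≡E (empiricalDot M μx μy)) (E-empiricalDot (λ z → z)) ⟩
    E₂ X Y (λ wx wy → Σ[V] (λ i → empirical M wx i * empirical M wy i))
      ≡⟨ E₂-∑ X Y V (λ i wx wy → empirical M wx i * empirical M wy i) ⟩
    Σ[V] (λ i → E₂ X Y (λ wx wy → empirical M wx i * empirical M wy i))
      ≡⟨ ∑-cong V (λ i → trans (E₂-* X Y (λ wx → empirical M wx i) (λ wy → empirical M wy i))
                               (cong₂ _*_ (E-empirical mass-μx M μx≗p i) (E-empirical mass-μy M μy≗q i))) ⟩
    inner p q ∎
    where open ≡-Reasoning

  E-empiricalDot² : E (empiricalDot M μx μy) (λ z → z * z)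
                    ≡ Σ[V] (λ i → Σ[V] (λ j → empiricalMoment m p i j * empiricalMoment m q i j))
  E-empiricalDot² = begin
    E (empiricalDot M μx μy) (λ z → z * z)
      ≡⟨ E-empiricalDot (λ z → z * z) ⟩
    E₂ X Y (λ wx wy → inner (empirical M wx) (empirical M wy) * inner (empirical M wx) (empirical M wy))
      ≡⟨ E₂-cong X Y (λ wx wy → trans (∑-*-∑ V V _ _) (∑-cong V (λ i → ∑-cong V (λ j →
           regroup (empirical M wx i) (empirical M wy i) (empirical M wx j) (empirical M wy j))))) ⟩
    E₂ X Y (λ wx wy → Σ[V] (λ i → Σ[V] (λ j → (empirical M wx i * empirical M wx j) * (empirical M wy i * empirical M wy j))))
      ≡⟨ trans (E₂-∑ X Y V _) (∑-cong V (λ i → E₂-∑ X Y V _)) ⟩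
    Σ[V] (λ i → Σ[V] (λ j → E₂ X Y (λ wx wy → (empirical M wx i * empirical M wx j) * (empirical M wy i * empirical M wy j))))
      ≡⟨ ∑-cong V (λ i → ∑-cong V (λ j → trans (E₂-* X Y _ _)
           (cong₂ _*_ (E-empirical* mass-μx M μx≗p i j) (E-empirical* mass-μy M μy≗q i j)))) ⟩
    Σ[V] (λ i → Σ[V] (λ j → empiricalMoment m p i j * empiricalMoment m q i j)) ∎
    where
    open ≡-Reasoning
    regroup : ∀ a b c d → (a * b) * (c * d) ≡ (a * c) * (b * d)
    regroup = solve 4 (λ a b c d → (a :* b) :* (c :* d) := (a :* c) :* (b :* d)) refl

  Var-empiricalDot-≤ : (∀ i → 0ℚ ≤ℚ p i) → (∀ i → 0ℚ ≤ℚ q i) → ∀ {a b} → 0ℚ ≤ℚ a → 0ℚ ≤ℚ b →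
                       normSq p ≤ℚ a * a → normSq q ≤ℚ b * b →
                       Var (empiricalDot M μx μy) ≤ℚ m * (m * (a * b) + (a * (b * b) + (a * a) * b))
  Var-empiricalDot-≤ 0≤p 0≤q {a} {b} 0≤a 0≤b ‖p‖²≤a² ‖q‖²≤b² = begin
    Var (empiricalDot M μx μy)
      ≡⟨ cong₂ (λ u v → u - v * v) (trans (𝔼-mapD (λ z → z * z) (empiricalDot M μx μy)) second-moment) 𝔼-empiricalDot ⟩
    Σ[V] (λ i → (p i * q i) * weight (p i + q i)) - s * s
      ≤⟨ ℚ.+-monoˡ-≤ (ℚ.- (s * s)) (∑-mono-≤ V (λ i → *-monoˡ-≤-0≤ (0≤pq i) (weight-mono (p i + q i) (a + b) (ℚ.+-mono-≤ (p≤a i) (q≤b i))))) ⟩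
    Σ[V] (λ i → (p i * q i) * weight (a + b)) - s * s
      ≡⟨ cong (_- s * s) (∑-*ʳ V (weight (a + b)) (λ i → p i * q i)) ⟩
    s * weight (a + b) - s * s
      ≤⟨ variance-polynomial-≤ (inv-nonNeg M) (inv≤1 M) 0≤a 0≤b (∑-nonNeg V 0≤pq) (inner≤ 0≤a 0≤b p q ‖p‖²≤a² ‖q‖²≤b²) ⟩
    m * (m * (a * b) + (a * (b * b) + (a * a) * b)) ∎
    where
    open ℚ.≤-Reasoning
    s : ℚ
    s = inner p q
    weight : ℚ → ℚ
    weight r = m * m + m * (1ℚ - m) * r + (1ℚ - m) * (1ℚ - m) * s
    weight-mono : ∀ r r′ → r ≤ℚ r′ → weight r ≤ℚ weight r′
    weight-mono r r′ r≤r′ = ℚ.+-monoˡ-≤ _ (ℚ.+-monoʳ-≤ (m * m)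
      (*-monoˡ-≤-0≤ (*-nonNeg (inv-nonNeg M) (p≤q⇒0≤q-p (inv≤1 M))) r≤r′))
    0≤pq : ∀ i → 0ℚ ≤ℚ p i * q i
    0≤pq i = *-nonNeg (0≤p i) (0≤q i)
    p≤a : ∀ i → p i ≤ℚ a
    p≤a = entry≤ 0≤a p ‖p‖²≤a²
    q≤b : ∀ i → q i ≤ℚ b
    q≤b = entry≤ 0≤b q ‖q‖²≤b²
    second-moment : E (empiricalDot M μx μy) (λ z → z * z) ≡ Σ[V] (λ i → (p i * q i) * weight (p i + q i))
    second-moment = trans E-empiricalDot² (Σ[V]²-empiricalMoment-* m p q)

lemma2 : {n d : ℕ} (A : Adj n) → IsSimpleGraph A → IsRegular A d → 1 ≤ d →
         (R t M : ℕ) → 1 ≤ M → M ≤ R → M ∣ R → (x y : Fin n) →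
         let px = powM A d t (indicator x)
             py = powM A d t (indicator y)
             Z  = EstRWDot A d R t M x y
         in (𝔼 Z ≡ inner px py)
            × ((a b : ℚ) → 0ℚ ≤ℚ a → 0ℚ ≤ℚ b →
               normSq px ≤ℚ a * a → normSq py ≤ℚ b * b →
               Var Z ≤ℚ inv R * (inv M * (a * b) + (a * (b * b) + (a * a) * b)))
lemma2 {n} {d} A (A-sym , _) regular 1≤d R t (suc m) (s≤s z≤n) M≤R M∣R x y = 𝔼Z≡ , VarZ≤
  where
  M B : ℕ
  M = suc m
  B = R / M
  instance
    d≢0 : NonZero d
    d≢0 = >-nonZero 1≤d
    B≢0 : NonZero B
    B≢0 = >-nonZero (m≥n⇒m/n>0 M≤R)
  px py : Vecℚ n
  px = powM A d t (indicator x)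
  py = powM A d t (indicator y)
  open EmpiricalDot (walk A d t x) (walk A d t y) (mass-walk A d regular t x) (mass-walk A d regular t y) M
                    (density-walk A d A-sym t x) (density-walk A d A-sym t y)

  𝔼Z≡ : 𝔼 (EstRWDot A d R t M x y) ≡ inner px py
  𝔼Z≡ = trans (𝔼-sampleMean mass-empiricalDot B) 𝔼-empiricalDot

  VarZ≤ : (a b : ℚ) → 0ℚ ≤ℚ a → 0ℚ ≤ℚ b → normSq px ≤ℚ a * a → normSq py ≤ℚ b * b →
          Var (EstRWDot A d R t M x y) ≤ℚ inv R * (inv M * (a * b) + (a * (b * b) + (a * a) * b))
  VarZ≤ a b 0≤a 0≤b ‖px‖²≤a² ‖py‖²≤b² = begin
    Var (EstRWDot A d R t M x y)      ≡⟨ Var-sampleMean mass-empiricalDot B ⟩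
    inv B * Var (batchZ A d t M x y)  ≤⟨ *-monoˡ-≤-0≤ (inv-nonNeg B) (Var-empiricalDot-≤ (powM-nonNeg A d (indicator-nonNeg x) t)
                                            (powM-nonNeg A d (indicator-nonNeg y) t) 0≤a 0≤b ‖px‖²≤a² ‖py‖²≤b²) ⟩
    inv B * (inv M * bound)           ≡⟨ ℚ.*-assoc (inv B) (inv M) bound ⟨
    inv B * inv M * bound             ≡⟨ cong (_* bound) (inv-* B M) ⟨
    inv (B ℕ.* M) * bound             ≡⟨ cong (λ k → inv k * bound) (m/n*n≡m M∣R) ⟩
    inv R * bound                     ∎
    where
    open ℚ.≤-Reasoning
    bound : ℚ
    bound = inv M * (a * b) + (a * (b * b) + (a * a) * b)
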